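{- As formal power series in $x$, $$(c_2^2 +c_3^2) e^{\alpha x}+(c_3^2+ c_1^2)e^{\beta x}+ (c_1^2+ c_2^2)e^{\gamma x}=\frac{ -1}{22}\sum_{k=0}^\infty T_k^{(-4,1,4)}\frac{x^k}{k!}.$$
   Context: Let $\alpha,\beta,\gamma$ be the three distinct complex roots of $x^3-x^2-x-1=0$, and set $c_1=\frac{\alpha}{(\alpha-\beta)(\alpha-\gamma)}$, $c_2=\frac{\beta}{(\beta-\alpha)(\beta-\gamma)}$, $c_3=\frac{\gamma}{(\gamma-\alpha)(\gamma-\beta)}$. For numbers $s_0,s_1,s_2$, the sequence $T_k^{(s_0,s_1,s_2)}$ is defined by $T_0^{(s_0,s_1,s_2)}=s_0$, $T_1^{(s_0,s_1,s_2)}=s_1$, $T_2^{(s_0,s_1,s_2)}=s_2$ and $T_k^{(s_0,s_1,s_2)}=T_{k-1}^{(s_0,s_1,s_2)}+T_{k-2}^{(s_0,s_1,s_2)}+T_{k-3}^{(s_0,s_1,s_2)}$ for $k\ge3$. -}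

module Defs where

open import Level using (_⊔_) renaming (suc to lsuc)
open import Data.Nat using (ℕ; zero; suc; _!)
open import Algebra.Bundles using (CommutativeRing)
open import Relation.Nullary using (¬_)

natToRing : ∀ {c ℓ} (R : CommutativeRing c ℓ) → ℕ → CommutativeRing.Carrier R
natToRing R zero    = CommutativeRing.0# R
natToRing R (suc n) = CommutativeRing._+_ R (CommutativeRing.1# R) (natToRing R n)

record CharZeroField c ℓ : Set (lsuc (c ⊔ ℓ)) where
  field
    commutativeRing : CommutativeRing c ℓ
  open CommutativeRing commutativeRing public
  field
    _⁻¹      : Carrier → Carrier
    inverseʳ : ∀ x → ¬ (x ≈ 0#) → x * (x ⁻¹) ≈ 1#
    0≉1      : ¬ (0# ≈ 1#)
    charZero : ∀ n → ¬ (natToRing commutativeRing (suc n) ≈ 0#)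

  ι : ℕ → Carrier
  ι = natToRing commutativeRing

module Series {c ℓ} (F : CharZeroField c ℓ) where
  open CharZeroField F

  pow : Carrier → ℕ → Carrier
  pow a zero    = 1#
  pow a (suc k) = a * pow a k

  -- formal power series in x over F: k-th coefficient (of x^k)
  FPS : Set c
  FPS = ℕ → Carrier

  _≈ₛ_ : FPS → FPS → Set ℓ
  f ≈ₛ g = ∀ k → f k ≈ g k

  _+ₛ_ : FPS → FPS → FPS
  (f +ₛ g) k = f k + g k

  _·ₛ_ : Carrier → FPS → FPS
  (a ·ₛ f) k = a * f k

  expS : Carrier → FPS
  expS a k = pow a k * (ι (k !)) ⁻¹

  egf : (ℕ → Carrier) → FPS
  egf t k = t k * (ι (k !)) ⁻¹

  T : Carrier → Carrier → Carrier → ℕ → Carrier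
  T s0 s1 s2 zero                = s0
  T s0 s1 s2 (suc zero)          = s1
  T s0 s1 s2 (suc (suc zero))    = s2
  T s0 s1 s2 (suc (suc (suc k))) =
    T s0 s1 s2 (suc (suc k)) + T s0 s1 s2 (suc k) + T s0 s1 s2 k

  IsRoot : Carrier → Set ℓ
  IsRoot x = pow x 3 - pow x 2 - x - 1# ≈ 0#

  cc : Carrier → Carrier → Carrier → Carrier
  cc a b d = a * ((a - b) * (a - d)) ⁻¹

-- Vieta's relations for the pairwise distinct roots give α + β + γ = 1 and
-- βγ = α² − α − 1, hence (α − β)(α − γ) = P′(α) for P(t) = t³ − t² − t − 1,
-- and reducing modulo P(α) yields 44 c₁² = 1 + 4α − α².  Consequently
-- 44 (c₂² + c₃²) = (α − 1)(α − 3), so k! times the k-th coefficient of the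
-- left-hand side is a combination of α^k, β^k, γ^k.  Such a sequence satisfies
-- the tribonacci recurrence because α, β, γ are roots of P, and so does
-- T^(−4,1,4); it therefore suffices to compare them for k = 0, 1, 2, which only
-- needs the power sums α + β + γ = 1 and α² + β² + γ² = 3.

module Submission where

open import Defs
open import Algebra.Bundles using (CommutativeRing)
open import Data.Nat as ℕ using (ℕ; zero; suc)
open import Data.Integer as ℤ using (ℤ; +_; -[1+_])
open import Data.Integer.Properties using ([1+m]⊖[1+n]≡m⊖n)
open import Data.Nat.Properties using (+-suc)
open import Data.Sign as Sign using (Sign)
open import Data.Maybe using (Maybe; just; nothing)
open import Relation.Nullary using (¬_; yes; no)
open import Relation.Binary.PropositionalEquality as ≡ using (_≡_)
open import Algebra.Solver.Ring.AlmostCommutativeRing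
  using (_-Raw-AlmostCommutative⟶_; fromCommutativeRing)

module IntegerCoefficients {c ℓ} (R : CommutativeRing c ℓ) where
  open CommutativeRing R
  open import Algebra.Properties.Ring ring using (-0#≈0#; -‿involutive; -‿distribˡ-*; -‿distribʳ-*)
  open import Algebra.Properties.AbelianGroup +-abelianGroup using (⁻¹-∙-comm)
  open import Algebra.Properties.CommutativeSemigroup +-commutativeSemigroup using (interchange)
  open import Algebra.Properties.Semiring.Mult semiring using (_×_; ×-homo-+; ×1-homo-*)
  open import Relation.Binary.Reasoning.Setoid setoid

  -- For a numeral n, both fromℤ (+ n) and ι n normalise to 1# + (… + (1# + 0#)),
  -- so the solver's constants match the ι-numerals of the statement definitionally.
  fromℤ : ℤ → Carrier
  fromℤ (+ n)    = n × 1#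
  fromℤ -[1+ n ] = - (suc n × 1#)

  fromℤ-neg : ∀ i → fromℤ (ℤ.- i) ≈ - fromℤ i
  fromℤ-neg (+ zero)  = sym -0#≈0#
  fromℤ-neg (+ suc n) = refl
  fromℤ-neg -[1+ n ]  = sym (-‿involutive _)

  1+a-[1+b]≈a-b : ∀ a b → (1# + a) - (1# + b) ≈ a - b
  1+a-[1+b]≈a-b a b = begin
    (1# + a) + - (1# + b)     ≈⟨ +-congˡ (⁻¹-∙-comm 1# b) ⟨
    (1# + a) + (- 1# + - b)   ≈⟨ interchange 1# a (- 1#) (- b) ⟩
    (1# - 1#) + (a - b)       ≈⟨ +-congʳ (-‿inverseʳ 1#) ⟩
    0# + (a - b)              ≈⟨ +-identityˡ _ ⟩
    a - b                     ∎

  fromℤ-⊖ : ∀ m n → fromℤ (m ℤ.⊖ n) ≈ m × 1# - n × 1#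
  fromℤ-⊖ zero    zero    = sym (-‿inverseʳ 0#)
  fromℤ-⊖ zero    (suc n) = sym (+-identityˡ _)
  fromℤ-⊖ (suc m) zero    = sym (trans (+-congˡ -0#≈0#) (+-identityʳ _))
  fromℤ-⊖ (suc m) (suc n) = begin
    fromℤ (suc m ℤ.⊖ suc n)   ≡⟨ ≡.cong fromℤ ([1+m]⊖[1+n]≡m⊖n m n) ⟩
    fromℤ (m ℤ.⊖ n)           ≈⟨ fromℤ-⊖ m n ⟩
    m × 1# - n × 1#           ≈⟨ 1+a-[1+b]≈a-b _ _ ⟨
    suc m × 1# - suc n × 1#   ∎

  fromℤ-+ : ∀ i j → fromℤ (i ℤ.+ j) ≈ fromℤ i + fromℤ j
  fromℤ-+ (+ m)    (+ n)    = ×-homo-+ 1# m n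
  fromℤ-+ (+ m)    -[1+ n ] = fromℤ-⊖ m (suc n)
  fromℤ-+ -[1+ m ] (+ n)    = trans (fromℤ-⊖ n (suc m)) (+-comm _ _)
  fromℤ-+ -[1+ m ] -[1+ n ] = begin
    - (suc (suc (m ℕ.+ n)) × 1#)     ≡⟨ ≡.cong (λ k → - (suc k × 1#)) (+-suc m n) ⟨
    - ((suc m ℕ.+ suc n) × 1#)       ≈⟨ -‿cong (×-homo-+ 1# (suc m) (suc n)) ⟩
    - (suc m × 1# + suc n × 1#)      ≈⟨ ⁻¹-∙-comm _ _ ⟨
    - (suc m × 1#) + - (suc n × 1#)  ∎

  signed : Sign → Carrier → Carrier
  signed Sign.+ x = x
  signed Sign.- x = - x

  signed-cong : ∀ s {x y} → x ≈ y → signed s x ≈ signed s y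
  signed-cong Sign.+ x≈y = x≈y
  signed-cong Sign.- x≈y = -‿cong x≈y

  signed-* : ∀ s t x y → signed (s Sign.* t) (x * y) ≈ signed s x * signed t y
  signed-* Sign.+ Sign.+ x y = refl
  signed-* Sign.+ Sign.- x y = -‿distribʳ-* x y
  signed-* Sign.- Sign.+ x y = -‿distribˡ-* x y
  signed-* Sign.- Sign.- x y = begin
    x * y          ≈⟨ -‿involutive _ ⟨
    - - (x * y)    ≈⟨ -‿cong (-‿distribʳ-* x y) ⟩
    - (x * - y)    ≈⟨ -‿distribˡ-* x (- y) ⟩
    - x * - y      ∎

  fromℤ-◃ : ∀ s n → fromℤ (s ℤ.◃ n) ≈ signed s (n × 1#)
  fromℤ-◃ Sign.+ zero    = refl
  fromℤ-◃ Sign.- zero    = sym -0#≈0#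
  fromℤ-◃ Sign.+ (suc n) = refl
  fromℤ-◃ Sign.- (suc n) = refl

  fromℤ-signAbs : ∀ i → fromℤ i ≈ signed (ℤ.sign i) (ℤ.∣ i ∣ × 1#)
  fromℤ-signAbs (+ n)    = refl
  fromℤ-signAbs -[1+ n ] = refl

  fromℤ-* : ∀ i j → fromℤ (i ℤ.* j) ≈ fromℤ i * fromℤ j
  fromℤ-* i j = begin
    fromℤ (s ℤ.◃ ℤ.∣ i ∣ ℕ.* ℤ.∣ j ∣)              ≈⟨ fromℤ-◃ s (ℤ.∣ i ∣ ℕ.* ℤ.∣ j ∣) ⟩
    signed s ((ℤ.∣ i ∣ ℕ.* ℤ.∣ j ∣) × 1#)          ≈⟨ signed-cong s (×1-homo-* ℤ.∣ i ∣ ℤ.∣ j ∣) ⟩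
    signed s (ℤ.∣ i ∣ × 1# * ℤ.∣ j ∣ × 1#)         ≈⟨ signed-* (ℤ.sign i) (ℤ.sign j) _ _ ⟩
    signed (ℤ.sign i) (ℤ.∣ i ∣ × 1#) * signed (ℤ.sign j) (ℤ.∣ j ∣ × 1#)
                                                  ≈⟨ *-cong (fromℤ-signAbs i) (fromℤ-signAbs j) ⟨
    fromℤ i * fromℤ j                              ∎
    where s = ℤ.sign i Sign.* ℤ.sign j

  fromℤ-homomorphism : ℤ.+-*-rawRing -Raw-AlmostCommutative⟶ fromCommutativeRing R
  fromℤ-homomorphism = record
    { ⟦_⟧ = fromℤ ; +-homo = fromℤ-+ ; *-homo = fromℤ-* ; -‿homo = fromℤ-neg
    ; 0-homo = refl ; 1-homo = +-identityʳ 1# }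

  fromℤ-≟ : ∀ i j → Maybe (fromℤ i ≈ fromℤ j)
  fromℤ-≟ i j with i ℤ.≟ j
  ... | yes ≡.refl = just refl
  ... | no _       = nothing

  open import Algebra.Solver.Ring ℤ.+-*-rawRing (fromCommutativeRing R) fromℤ-homomorphism fromℤ-≟ public

module CubicRoots {c ℓ} (F : CharZeroField c ℓ) where
  open CharZeroField F
  open Series F
  open IntegerCoefficients commutativeRing
  open import Algebra.Properties.Group +-group
    using () renaming (x≈y⇒x∙y⁻¹≈ε to x≈y⇒x-y≈0; x∙y⁻¹≈ε⇒x≈y to x-y≈0⇒x≈y)
  open import Relation.Binary.Reasoning.Setoid setoid

  κ : ∀ {n} → ℕ → Polynomial n
  κ k = con (+ k)

  -- κ 1 denotes 1# + 0#, not 1#.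
  :1 : ∀ {n} → Polynomial n
  :1 = con (+ 1) :^ 0

  cubic : Carrier → Carrier
  cubic x = pow x 3 - pow x 2 - x - 1#

  cubicₚ : ∀ {n} → Polynomial n → Polynomial n
  cubicₚ x = x :^ 3 :- x :^ 2 :- x :- :1

  -- Identities holding modulo relations z ≈ 0# are proved as exact identities
  -- a ≈ (b + z₁ * h₁) + … + zₙ * hₙ, checked by the solver, whose null summands
  -- are then dropped from the outside in.
  drop-null : ∀ {a b z h} → z ≈ 0# → a ≈ b + z * h → a ≈ b
  drop-null {b = b} {h = h} z≈0 a≈b+zh = begin
    _          ≈⟨ a≈b+zh ⟩
    b + _ * h  ≈⟨ +-congˡ (*-congʳ z≈0) ⟩
    b + 0# * h ≈⟨ +-congˡ (zeroˡ h) ⟩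
    b + 0#     ≈⟨ +-identityʳ b ⟩
    b          ∎

  x*y≈0⇒y≈0 : ∀ {x y} → ¬ x ≈ 0# → x * y ≈ 0# → y ≈ 0#
  x*y≈0⇒y≈0 {x} {y} x≉0 xy≈0 = begin
    y                ≈⟨ drop-null (x≈y⇒x-y≈0 (inverseʳ x x≉0)) (inverse-expansion x (x ⁻¹) y) ⟩
    x ⁻¹ * (x * y)   ≈⟨ *-congˡ xy≈0 ⟩
    x ⁻¹ * 0#        ≈⟨ zeroʳ _ ⟩
    0#               ∎
    where
    inverse-expansion : ∀ x x′ y → y ≈ x′ * (x * y) + (x * x′ - 1#) * (- y)
    inverse-expansion = solve 3 (λ x x′ y → y := x′ :* (x :* y) :+ (x :* x′ :- :1) :* (:- y)) refl

  x≉y⇒x-y≉0 : ∀ {x y} → ¬ x ≈ y → ¬ x - y ≈ 0#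
  x≉y⇒x-y≉0 {x} {y} x≉y x-y≈0 = x≉y (x-y≈0⇒x≈y x y x-y≈0)

  *-nonzero : ∀ {x y} → ¬ x ≈ 0# → ¬ y ≈ 0# → ¬ x * y ≈ 0#
  *-nonzero x≉0 y≉0 xy≈0 = y≉0 (x*y≈0⇒y≈0 x≉0 xy≈0)

  distinct-roots-relation : ∀ {x y} → IsRoot x → IsRoot y → ¬ x ≈ y →
                            x * x + x * y + y * y - x - y - 1# ≈ 0#
  distinct-roots-relation {x} {y} x-root y-root x≉y =
    x*y≈0⇒y≈0 (x≉y⇒x-y≉0 x≉y) (drop-null x-root (drop-null y-root (factorisation x y)))
    where
    factorisation : ∀ x y → (x - y) * (x * x + x * y + y * y - x - y - 1#)
                            ≈ (0# + cubic x * 1#) + cubic y * (- 1#)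
    factorisation = solve 2 (λ x y →
      (x :- y) :* (x :* x :+ x :* y :+ y :* y :- x :- y :- :1)
      := (κ 0 :+ cubicₚ x :* :1) :+ cubicₚ y :* (:- :1)) refl

  record DistinctRoots (x y z : Carrier) : Set ℓ where
    field
      root₁ : IsRoot x
      root₂ : IsRoot y
      root₃ : IsRoot z
      x≉y   : ¬ x ≈ y
      x≉z   : ¬ x ≈ z
      y≉z   : ¬ y ≈ z

  swap₁₂ : ∀ {x y z} → DistinctRoots x y z → DistinctRoots y x z
  swap₁₂ ρ = record
    { root₁ = root₂ ; root₂ = root₁ ; root₃ = root₃
    ; x≉y = λ y≈x → x≉y (sym y≈x) ; x≉z = y≉z ; y≉z = x≉z }
    where open DistinctRoots ρ

  rotate : ∀ {x y z} → DistinctRoots x y z → DistinctRoots z x y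
  rotate ρ = record
    { root₁ = root₃ ; root₂ = root₁ ; root₃ = root₂
    ; x≉y = λ z≈x → x≉z (sym z≈x) ; x≉z = λ z≈y → y≉z (sym z≈y) ; y≉z = x≉y }
    where open DistinctRoots ρ

  cubic′ : Carrier → Carrier
  cubic′ x = ι 3 * (x * x) - ι 2 * x - 1#

  cubic′ₚ : ∀ {n} → Polynomial n → Polynomial n
  cubic′ₚ x = κ 3 :* (x :* x) :- κ 2 :* x :- :1

  -- 44 (c_y² + c_z²) for the roots y, z other than x
  weight : Carrier → Carrier
  weight x = (x - 1#) * (x - ι 3)

  weightₚ : ∀ {n} → Polynomial n → Polynomial n
  weightₚ x = (x :- :1) :* (x :- κ 3)

  module _ {x y z} (ρ : DistinctRoots x y z) where
    open DistinctRoots ρ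

    roots-sum : x + y + z ≈ 1#
    roots-sum = x-y≈0⇒x≈y _ _ (x*y≈0⇒y≈0 (x≉y⇒x-y≉0 y≉z)
      (drop-null (distinct-roots-relation root₁ root₂ x≉y)
        (drop-null (distinct-roots-relation root₁ root₃ x≉z) (difference x y z))))
      where
      difference : ∀ x y z → (y - z) * (x + y + z - 1#)
        ≈ (0# + (x * x + x * y + y * y - x - y - 1#) * 1#) + (x * x + x * z + z * z - x - z - 1#) * (- 1#)
      difference = solve 3 (λ x y z → (y :- z) :* (x :+ y :+ z :- :1)
        := (κ 0 :+ (x :* x :+ x :* y :+ y :* y :- x :- y :- :1) :* :1)
           :+ (x :* x :+ x :* z :+ z :* z :- x :- z :- :1) :* (:- :1)) refl

    other-roots-product : y * z ≈ x * x - x - 1#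
    other-roots-product =
      drop-null (x≈y⇒x-y≈0 roots-sum)
        (drop-null (distinct-roots-relation root₂ root₃ y≉z) (expansion x y z))
      where
      expansion : ∀ x y z → y * z
        ≈ ((x * x - x - 1#) + (x + y + z - 1#) * (y + z - x)) + (y * y + y * z + z * z - y - z - 1#) * (- 1#)
      expansion = solve 3 (λ x y z → y :* z
        := ((x :* x :- x :- :1) :+ (x :+ y :+ z :- :1) :* (y :+ z :- x))
           :+ (y :* y :+ y :* z :+ z :* z :- y :- z :- :1) :* (:- :1)) refl

    roots-square-sum : x * x + y * y + z * z ≈ ι 3
    roots-square-sum =
      drop-null (x≈y⇒x-y≈0 roots-sum)
        (drop-null (distinct-roots-relation root₂ root₃ y≉z) (expansion x y z))
      where
      expansion : ∀ x y z → x * x + y * y + z * z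
        ≈ (ι 3 + (x + y + z - 1#) * (1# + x - y - z)) + (y * y + y * z + z * z - y - z - 1#) * ι 2
      expansion = solve 3 (λ x y z → x :* x :+ y :* y :+ z :* z
        := (κ 3 :+ (x :+ y :+ z :- :1) :* (:1 :+ x :- y :- z))
           :+ (y :* y :+ y :* z :+ z :* z :- y :- z :- :1) :* κ 2) refl

    differences-product : (x - y) * (x - z) ≈ cubic′ x
    differences-product =
      drop-null (x≈y⇒x-y≈0 roots-sum) (drop-null (x≈y⇒x-y≈0 other-roots-product) (expansion x y z))
      where
      expansion : ∀ x y z → (x - y) * (x - z)
        ≈ (cubic′ x + (x + y + z - 1#) * (- x)) + (y * z - (x * x - x - 1#)) * 1#
      expansion = solve 3 (λ x y z → (x :- y) :* (x :- z)
        := (cubic′ₚ x :+ (x :+ y :+ z :- :1) :* (:- x)) :+ (y :* z :- (x :* x :- x :- :1)) :* :1) refl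

    cc-square : ι 44 * (cc x y z * cc x y z) ≈ 1# + ι 4 * x - x * x
    cc-square = begin
      ι 44 * (x * u * (x * u))          ≈⟨ square-regroup (ι 44) x u ⟩
      ι 44 * (x * x) * (u * u)          ≈⟨ *-congʳ (drop-null root₁ (reduction x)) ⟩
      D * (cubic′ x * cubic′ x) * (u * u) ≈⟨ *-congʳ (*-congˡ (*-cong differences-product differences-product)) ⟨
      D * (d * d) * (u * u)             ≈⟨ square-regroup D d u ⟨
      D * (d * u * (d * u))             ≈⟨ *-congˡ (*-cong d*u≈1 d*u≈1) ⟩
      D * (1# * 1#)                     ≈⟨ *-congˡ (*-identityˡ 1#) ⟩
      D * 1#                            ≈⟨ *-identityʳ D ⟩
      D                                 ∎
      where
      d u D : Carrier
      d = (x - y) * (x - z)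
      u = d ⁻¹
      D = 1# + ι 4 * x - x * x
      d*u≈1 : d * u ≈ 1#
      d*u≈1 = inverseʳ d (*-nonzero (x≉y⇒x-y≉0 x≉y) (x≉y⇒x-y≉0 x≉z))
      square-regroup : ∀ k a b → k * (a * b * (a * b)) ≈ k * (a * a) * (b * b)
      square-regroup = solve 3 (λ k a b → k :* (a :* b :* (a :* b)) := k :* (a :* a) :* (b :* b)) refl
      reduction : ∀ x → ι 44 * (x * x)
        ≈ (1# + ι 4 * x - x * x) * (cubic′ x * cubic′ x) + cubic x * (1# + ι 7 * x - ι 39 * (x * x) + ι 9 * (x * x * x))
      reduction = solve 1 (λ x → κ 44 :* (x :* x)
        := (:1 :+ κ 4 :* x :- x :* x) :* (cubic′ₚ x :* cubic′ₚ x)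
           :+ cubicₚ x :* (:1 :+ κ 7 :* x :- κ 39 :* (x :* x) :+ κ 9 :* (x :* x :* x))) refl

    weight-from-other-roots : (1# + ι 4 * y - y * y) + (1# + ι 4 * z - z * z) ≈ weight x
    weight-from-other-roots =
      drop-null (x≈y⇒x-y≈0 roots-sum) (drop-null (x≈y⇒x-y≈0 roots-square-sum) (expansion x y z))
      where
      expansion : ∀ x y z → (1# + ι 4 * y - y * y) + (1# + ι 4 * z - z * z)
        ≈ (weight x + (x + y + z - 1#) * ι 4) + (x * x + y * y + z * z - ι 3) * (- 1#)
      expansion = solve 3 (λ x y z → (:1 :+ κ 4 :* y :- y :* y) :+ (:1 :+ κ 4 :* z :- z :* z)
        := ((x :- :1) :* (x :- κ 3) :+ (x :+ y :+ z :- :1) :* κ 4)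
           :+ (x :* x :+ y :* y :+ z :* z :- κ 3) :* (:- :1)) refl

  Tribonacci : (ℕ → Carrier) → Set ℓ
  Tribonacci s = ∀ k → s (suc (suc (suc k))) ≈ s (suc (suc k)) + s (suc k) + s k

  T-tribonacci : ∀ s₀ s₁ s₂ → Tribonacci (T s₀ s₁ s₂)
  T-tribonacci s₀ s₁ s₂ k = refl

  pow-tribonacci : ∀ {x} → IsRoot x → Tribonacci (pow x)
  pow-tribonacci {x} x-root k = drop-null x-root (expansion x (pow x k))
    where
    expansion : ∀ x p → x * (x * (x * p)) ≈ (x * (x * p) + x * p + p) + cubic x * p
    expansion = solve 2 (λ x p → x :* (x :* (x :* p)) := (x :* (x :* p) :+ x :* p :+ p) :+ cubicₚ x :* p) refl

  tribonacci-scale : ∀ a {s} → Tribonacci s → Tribonacci (λ k → a * s k)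
  tribonacci-scale a s-rec k = trans (*-congˡ (s-rec k)) (trans (distribˡ a _ _) (+-congʳ (distribˡ a _ _)))

  tribonacci-+ : ∀ {s t} → Tribonacci s → Tribonacci t → Tribonacci (λ k → s k + t k)
  tribonacci-+ s-rec t-rec k = trans (+-cong (s-rec k) (t-rec k)) (regroup _ _ _ _ _ _)
    where
    regroup : ∀ a b c a′ b′ c′ → (a + b + c) + (a′ + b′ + c′) ≈ (a + a′) + (b + b′) + (c + c′)
    regroup = solve 6 (λ a b c a′ b′ c′ → (a :+ b :+ c) :+ (a′ :+ b′ :+ c′) := (a :+ a′) :+ (b :+ b′) :+ (c :+ c′)) refl

  tribonacci-unique : ∀ {s t} → Tribonacci s → Tribonacci t →
                      s 0 ≈ t 0 → s 1 ≈ t 1 → s 2 ≈ t 2 → ∀ k → s k ≈ t k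
  tribonacci-unique {s} {t} s-rec t-rec s₀≈t₀ s₁≈t₁ s₂≈t₂ = agree
    where
    agree : ∀ k → s k ≈ t k
    agree 0 = s₀≈t₀
    agree 1 = s₁≈t₁
    agree 2 = s₂≈t₂
    agree (suc (suc (suc k))) =
      trans (s-rec k) (trans (+-cong (+-cong (agree (suc (suc k))) (agree (suc k))) (agree k)) (sym (t-rec k)))

  powerSum : Carrier → Carrier → Carrier → Carrier → Carrier → Carrier → ℕ → Carrier
  powerSum a b d x y z k = a * pow x k + b * pow y k + d * pow z k

  powerSum-tribonacci : ∀ a b d {x y z} → IsRoot x → IsRoot y → IsRoot z → Tribonacci (powerSum a b d x y z)
  powerSum-tribonacci a b d x-root y-root z-root =
    tribonacci-+ (tribonacci-+ (tribonacci-scale a (pow-tribonacci x-root))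
                               (tribonacci-scale b (pow-tribonacci y-root)))
                 (tribonacci-scale d (pow-tribonacci z-root))

  powerSum-cong : ∀ {a a′ b b′ d d′} x y z k → a ≈ a′ → b ≈ b′ → d ≈ d′ →
                  powerSum a b d x y z k ≈ powerSum a′ b′ d′ x y z k
  powerSum-cong x y z k a≈a′ b≈b′ d≈d′ = +-cong (+-cong (*-congʳ a≈a′) (*-congʳ b≈b′)) (*-congʳ d≈d′)

  powerSum-scale : ∀ r a b d x y z k → r * powerSum a b d x y z k ≈ powerSum (r * a) (r * b) (r * d) x y z k
  powerSum-scale r a b d x y z k = distribution r a b d (pow x k) (pow y k) (pow z k)
    where
    distribution : ∀ r a b d p q s → r * (a * p + b * q + d * s) ≈ r * a * p + r * b * q + r * d * s
    distribution = solve 7 (λ r a b d p q s →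
      r :* (a :* p :+ b :* q :+ d :* s) := r :* a :* p :+ r :* b :* q :+ r :* d :* s) refl

  powerSum-*ʳ : ∀ a b d x y z k φ →
    a * (pow x k * φ) + b * (pow y k * φ) + d * (pow z k * φ) ≈ powerSum a b d x y z k * φ
  powerSum-*ʳ a b d x y z k φ = distribution a b d (pow x k) (pow y k) (pow z k) φ
    where
    distribution : ∀ a b d p q s φ → a * (p * φ) + b * (q * φ) + d * (s * φ) ≈ (a * p + b * q + d * s) * φ
    distribution = solve 7 (λ a b d p q s φ →
      a :* (p :* φ) :+ b :* (q :* φ) :+ d :* (s :* φ) := (a :* p :+ b :* q :+ d :* s) :* φ) refl

  weighted-powerSum : ∀ {x y z} → DistinctRoots x y z → ∀ k →
    powerSum (weight x) (weight y) (weight z) x y z k ≈ - ι 2 * T (- ι 4) (ι 1) (ι 4) k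
  weighted-powerSum {x} {y} {z} ρ = tribonacci-unique
    (powerSum-tribonacci _ _ _ root₁ root₂ root₃) (tribonacci-scale (- ι 2) (T-tribonacci _ _ _))
    (modulo-relations (initial₀ x y z)) (modulo-relations (initial₁ x y z)) (modulo-relations (initial₂ x y z))
    where
    open DistinctRoots ρ
    modulo-relations : ∀ {a v h₁ h₂ h₃ h₄ h₅} →
      a ≈ ((((v + (x + y + z - 1#) * h₁) + (x * x + y * y + z * z - ι 3) * h₂)
             + cubic x * h₃) + cubic y * h₄) + cubic z * h₅ →
      a ≈ v
    modulo-relations eq =
      drop-null (x≈y⇒x-y≈0 (roots-sum ρ)) (drop-null (x≈y⇒x-y≈0 (roots-square-sum ρ))
        (drop-null root₁ (drop-null root₂ (drop-null root₃ eq))))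
    initial₀ : ∀ x y z → powerSum (weight x) (weight y) (weight z) x y z 0
      ≈ ((((- ι 2 * - ι 4 + (x + y + z - 1#) * - ι 4) + (x * x + y * y + z * z - ι 3) * 1#)
           + cubic x * 0#) + cubic y * 0#) + cubic z * 0#
    initial₀ = solve 3 (λ x y z → weightₚ x :* x :^ 0 :+ weightₚ y :* y :^ 0 :+ weightₚ z :* z :^ 0
      := ((((:- κ 2 :* :- κ 4 :+ (x :+ y :+ z :- :1) :* :- κ 4) :+ (x :* x :+ y :* y :+ z :* z :- κ 3) :* :1)
           :+ cubicₚ x :* κ 0) :+ cubicₚ y :* κ 0) :+ cubicₚ z :* κ 0) refl
    initial₁ : ∀ x y z → powerSum (weight x) (weight y) (weight z) x y z 1
      ≈ ((((- ι 2 * ι 1 + (x + y + z - 1#) * ι 4) + (x * x + y * y + z * z - ι 3) * - ι 3)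
           + cubic x * 1#) + cubic y * 1#) + cubic z * 1#
    initial₁ = solve 3 (λ x y z → weightₚ x :* x :^ 1 :+ weightₚ y :* y :^ 1 :+ weightₚ z :* z :^ 1
      := ((((:- κ 2 :* κ 1 :+ (x :+ y :+ z :- :1) :* κ 4) :+ (x :* x :+ y :* y :+ z :* z :- κ 3) :* :- κ 3)
           :+ cubicₚ x :* :1) :+ cubicₚ y :* :1) :+ cubicₚ z :* :1) refl
    initial₂ : ∀ x y z → powerSum (weight x) (weight y) (weight z) x y z 2
      ≈ ((((- ι 2 * ι 4 + (x + y + z - 1#) * - ι 2) + (x * x + y * y + z * z - ι 3) * 1#)
           + cubic x * (x - ι 3)) + cubic y * (y - ι 3)) + cubic z * (z - ι 3)
    initial₂ = solve 3 (λ x y z → weightₚ x :* x :^ 2 :+ weightₚ y :* y :^ 2 :+ weightₚ z :* z :^ 2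
      := ((((:- κ 2 :* κ 4 :+ (x :+ y :+ z :- :1) :* :- κ 2) :+ (x :* x :+ y :* y :+ z :* z :- κ 3) :* :1)
           :+ cubicₚ x :* (x :- κ 3)) :+ cubicₚ y :* (y :- κ 3)) :+ cubicₚ z :* (z :- κ 3)) refl

  44*s≈-2*t⇒s≈-w*t : ∀ {w s t} → ι 22 * w ≈ 1# → ι 44 * s ≈ - ι 2 * t → s ≈ - w * t
  44*s≈-2*t⇒s≈-w*t {w} {s} {t} 22w≈1 44s≈-2t =
    drop-null (x≈y⇒x-y≈0 22w≈1) (drop-null 22s+t≈0 (expansion w s t))
    where
    doubling : ∀ s t → ι 2 * (ι 22 * s + t) ≈ 0# + (ι 44 * s - - ι 2 * t) * 1#
    doubling = solve 2 (λ s t → κ 2 :* (κ 22 :* s :+ t) := κ 0 :+ (κ 44 :* s :- :- κ 2 :* t) :* :1) refl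
    22s+t≈0 : ι 22 * s + t ≈ 0#
    22s+t≈0 = x*y≈0⇒y≈0 (charZero 1) (drop-null (x≈y⇒x-y≈0 44s≈-2t) (doubling s t))
    expansion : ∀ w s t → s ≈ (- w * t + (ι 22 * w - 1#) * (- s)) + (ι 22 * s + t) * w
    expansion = solve 3 (λ w s t → s := (:- w :* t :+ (κ 22 :* w :- :1) :* (:- s)) :+ (κ 22 :* s :+ t) :* w) refl

  cc-powerSum : ∀ {α β γ} → DistinctRoots α β γ → ∀ k →
    let c₁ = cc α β γ
        c₂ = cc β α γ
        c₃ = cc γ α β
    in powerSum (c₂ * c₂ + c₃ * c₃) (c₃ * c₃ + c₁ * c₁) (c₁ * c₁ + c₂ * c₂) α β γ k
       ≈ - (ι 22 ⁻¹) * T (- ι 4) (ι 1) (ι 4) k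
  cc-powerSum {α} {β} {γ} ρ k = 44*s≈-2*t⇒s≈-w*t (inverseʳ (ι 22) (charZero 21)) (begin
    ι 44 * powerSum A B C α β γ k
      ≈⟨ powerSum-scale (ι 44) A B C α β γ k ⟩
    powerSum (ι 44 * A) (ι 44 * B) (ι 44 * C) α β γ k
      ≈⟨ powerSum-cong α β γ k
           (weight-from (cc-square (swap₁₂ ρ)) (cc-square (rotate ρ)) (weight-from-other-roots ρ))
           (weight-from (cc-square (rotate ρ)) (cc-square ρ) (weight-from-other-roots (rotate (rotate ρ))))
           (weight-from (cc-square ρ) (cc-square (swap₁₂ ρ)) (weight-from-other-roots (rotate ρ))) ⟩
    powerSum (weight α) (weight β) (weight γ) α β γ k
      ≈⟨ weighted-powerSum ρ k ⟩
    - ι 2 * T (- ι 4) (ι 1) (ι 4) k ∎)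
    where
    A B C : Carrier
    A = cc β α γ * cc β α γ + cc γ α β * cc γ α β
    B = cc γ α β * cc γ α β + cc α β γ * cc α β γ
    C = cc α β γ * cc α β γ + cc β α γ * cc β α γ
    weight-from : ∀ {a b p q w} → ι 44 * a ≈ p → ι 44 * b ≈ q → p + q ≈ w → ι 44 * (a + b) ≈ w
    weight-from 44a≈p 44b≈q p+q≈w = trans (distribˡ (ι 44) _ _) (trans (+-cong 44a≈p 44b≈q) p+q≈w)

corollary3 : ∀ {c ℓ} (F : CharZeroField c ℓ) →
    let open CharZeroField F
        open Series F
    in (α β γ : Carrier) → IsRoot α → IsRoot β → IsRoot γ →
       ¬ (α ≈ β) → ¬ (α ≈ γ) → ¬ (β ≈ γ) →
       let c₁ = cc α β γ
           c₂ = cc β α γ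
           c₃ = cc γ α β
       in ((((c₂ * c₂ + c₃ * c₃) ·ₛ expS α)
             +ₛ ((c₃ * c₃ + c₁ * c₁) ·ₛ expS β))
             +ₛ ((c₁ * c₁ + c₂ * c₂) ·ₛ expS γ))
          ≈ₛ ((- (ι 22 ⁻¹)) ·ₛ egf (T (- ι 4) (ι 1) (ι 4)))
corollary3 F α β γ α-root β-root γ-root α≉β α≉γ β≉γ k =
  trans (powerSum-*ʳ _ _ _ α β γ k _) (trans (*-congʳ (cc-powerSum ρ k)) (*-assoc _ _ _))
  where
  open CharZeroField F
  open CubicRoots F
  ρ : DistinctRoots α β γ
  ρ = record { root₁ = α-root ; root₂ = β-root ; root₃ = γ-root ; x≉y = α≉β ; x≉z = α≉γ ; y≉z = β≉γ }
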